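{- Let $k\le\ell$ be positive integers and $\psi=\lceil\ell/k\rceil$. If $(\mathbf{m},\mathbf{n})\in\widetilde{\mathcal{D}}(k,\ell)$, then $m_i\ge\psi$ for every $i\in\{1,\dots,k\}$.
   Context: $\mathbb{N}=\{1,2,\dots\}$, $\mathbb{N}_0=\mathbb{N}\cup\{0\}$. For $\mathbf{r}\in\mathbb{N}_0^r$ and $\mathbf{s}\in\mathbb{N}_0^s$, $\mathcal{A}(\mathbf{r},\mathbf{s})$ is the set of $r\times s$ matrices with entries in $\{0,1\}$ whose row-sum vector is $\mathbf{r}$ and column-sum vector is $\mathbf{s}$. For $k,\ell\in\mathbb{N}$, $\widetilde{\mathcal{D}}(k,\ell)$ is the set of pairs $(\mathbf{m},\mathbf{n})\in\mathbb{N}^k\times\mathbb{N}^\ell$ for which there exist $s\in\mathbb{N}$, $\mathbf{r}\in\mathbb{N}_0^s$, $V\in\mathcal{A}(\mathbf{r},\mathbf{m})$ and $W\in\mathcal{A}(\mathbf{r},\mathbf{n})$ such that every entry of $V^\top W$ is a positive integer. -}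

module Defs where

open import Data.Nat using (ℕ; zero; suc; _+_; _*_; _∸_; _<_; _≤_; NonZero)
open import Data.Nat.DivMod using (_/_)
open import Data.Fin using (Fin; zero; suc)
open import Data.Bool using (Bool; true; false)
open import Data.Product using (Σ; _×_; ∃; ∃-syntax)
open import Relation.Binary.PropositionalEquality using (_≡_)

sumFin : (n : ℕ) → (Fin n → ℕ) → ℕ
sumFin zero    f = 0
sumFin (suc n) f = f zero + sumFin n (λ i → f (suc i))

b2n : Bool → ℕ
b2n true  = 1
b2n false = 0

BinMat : ℕ → ℕ → Set
BinMat r s = Fin r → Fin s → Bool

InA : {r s : ℕ} → (Fin r → ℕ) → (Fin s → ℕ) → BinMat r s → Set
InA {r} {s} rv sv M =
  ((i : Fin r) → sumFin s (λ j → b2n (M i j)) ≡ rv i) ×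
  ((j : Fin s) → sumFin r (λ i → b2n (M i j)) ≡ sv j)

transMul : {s k ℓ : ℕ} → BinMat s k → BinMat s ℓ → Fin k → Fin ℓ → ℕ
transMul {s} V W i j = sumFin s (λ t → b2n (V t i) * b2n (W t j))

Positive : {n : ℕ} → (Fin n → ℕ) → Set
Positive {n} v = (i : Fin n) → 1 ≤ v i

InDtilde : (k ℓ : ℕ) → (Fin k → ℕ) → (Fin ℓ → ℕ) → Set
InDtilde k ℓ m n =
  Positive m × Positive n ×
  ∃[ s ] (1 ≤ s × Σ (Fin s → ℕ) λ rv →
    Σ (BinMat s k) λ V → Σ (BinMat s ℓ) λ W →
      InA rv m V × InA rv n W ×
      ((i : Fin k) (j : Fin ℓ) → 1 ≤ transMul V W i j))

ceilDiv : (a b : ℕ) → .{{NonZero b}} → ℕ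
ceilDiv a b = (a + (b ∸ 1)) / b

-- Fix a row i of Vᵀ W. Counting its entries through the rows t of the matrices,
-- ℓ ≤ Σ_j (Vᵀ W)_{i j} = Σ_t V_{t i} r_t, since row t of W has r_t ones. Row t of V
-- is a 0/1 vector of length k, so r_t ≤ k, and column i of V has m_i ones, whence
-- ℓ ≤ k m_i, i.e. m_i ≥ ⌈ℓ/k⌉.
module Submission where

open import Defs
open import Data.Nat using (ℕ; _≤_; NonZero; zero; suc; _+_; _*_; s≤s; z≤n; s≤s⁻¹)
open import Data.Nat.Properties
open import Data.Nat.DivMod using (m<n*o⇒m/o<n)
open import Data.Fin using (Fin; zero; suc)
open import Data.Bool using (Bool; true; false)
open import Data.Product using (_,_)
open import Data.Vec.Functional using (Vector)
open import Function using (_∘_)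
open import Relation.Binary.PropositionalEquality
open import Algebra.Properties.Semiring.Sum +-*-semiring using (sum; sum-syntax; sum-cong-≗; ∑-comm; *-distribˡ-sum)

sumFin≡sum : ∀ n (f : Vector ℕ n) → sumFin n f ≡ sum f
sumFin≡sum zero    f = refl
sumFin≡sum (suc n) f = cong (f zero +_) (sumFin≡sum n (f ∘ suc))

sum-mono-≤ : ∀ {n} {f g : Vector ℕ n} → (∀ i → f i ≤ g i) → sum f ≤ sum g
sum-mono-≤ {zero}  f≤g = z≤n
sum-mono-≤ {suc n} f≤g = +-mono-≤ (f≤g zero) (sum-mono-≤ (f≤g ∘ suc))

length≤sumFin : ∀ n (f : Vector ℕ n) → (∀ i → 1 ≤ f i) → n ≤ sumFin n f
length≤sumFin zero    f 1≤f = z≤n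
length≤sumFin (suc n) f 1≤f = +-mono-≤ (1≤f zero) (length≤sumFin n (f ∘ suc) (1≤f ∘ suc))

b2n≤1 : ∀ b → b2n b ≤ 1
b2n≤1 true  = s≤s z≤n
b2n≤1 false = z≤n

sumFin-b2n≤length : ∀ n (f : Vector Bool n) → sumFin n (b2n ∘ f) ≤ n
sumFin-b2n≤length zero    f = z≤n
sumFin-b2n≤length (suc n) f = +-mono-≤ (b2n≤1 (f zero)) (sumFin-b2n≤length n (f ∘ suc))

∑-weighted-≤ : ∀ {n} c (x y : Vector ℕ n) → (∀ t → x t ≤ c) → ∑[ t < n ] (y t * x t) ≤ c * sum y
∑-weighted-≤ c x y x≤c = begin
  ∑[ t < _ ] (y t * x t)   ≤⟨ sum-mono-≤ (λ t → *-monoʳ-≤ (y t) (x≤c t)) ⟩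
  ∑[ t < _ ] (y t * c)     ≡⟨ sum-cong-≗ (λ t → *-comm (y t) c) ⟩
  ∑[ t < _ ] (c * y t)     ≡⟨ *-distribˡ-sum c y ⟨
  c * sum y                ∎
  where open ≤-Reasoning

ceilDiv-least : ∀ a b c .{{_ : NonZero b}} → a ≤ c * b → ceilDiv a b ≤ c
ceilDiv-least a (suc b) c a≤cb = s≤s⁻¹ (m<n*o⇒m/o<n {a + b} {suc c} {suc b} (begin-strict
  a + b               ≤⟨ +-monoˡ-≤ b a≤cb ⟩
  c * suc b + b       <⟨ +-monoʳ-< (c * suc b) (n<1+n b) ⟩
  c * suc b + suc b   ≡⟨ +-comm (c * suc b) (suc b) ⟩
  suc c * suc b       ∎))
  where open ≤-Reasoning

rowSum-transMul : ∀ {s k ℓ} (V : BinMat s k) (W : BinMat s ℓ) (rv : Fin s → ℕ) →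
  (∀ t → sumFin ℓ (b2n ∘ W t) ≡ rv t) →
  ∀ i → sumFin ℓ (transMul V W i) ≡ ∑[ t < s ] (b2n (V t i) * rv t)
rowSum-transMul {s} {ℓ = ℓ} V W rv rowW i = begin
  sumFin ℓ (transMul V W i)                ≡⟨ sumFin≡sum ℓ _ ⟩
  ∑[ j < ℓ ] sumFin s (λ t → a t * w t j)  ≡⟨ sum-cong-≗ (λ j → sumFin≡sum s (λ t → a t * w t j)) ⟩
  ∑[ j < ℓ ] ∑[ t < s ] (a t * w t j)      ≡⟨ ∑-comm (λ j t → a t * w t j) ⟩
  ∑[ t < s ] ∑[ j < ℓ ] (a t * w t j)      ≡⟨ sum-cong-≗ (λ t → sym (*-distribˡ-sum (a t) (w t))) ⟩
  ∑[ t < s ] (a t * ∑[ j < ℓ ] w t j)      ≡⟨ sum-cong-≗ (λ t → cong (a t *_) (trans (sym (sumFin≡sum ℓ (w t))) (rowW t))) ⟩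
  ∑[ t < s ] (a t * rv t)                  ∎
  where
  open ≡-Reasoning
  a : Fin s → ℕ
  a t = b2n (V t i)
  w : Fin s → Fin ℓ → ℕ
  w t j = b2n (W t j)

lemma2p6 : (k ℓ : ℕ) → .{{_ : NonZero k}} → .{{_ : NonZero ℓ}} → k ≤ ℓ →
    (m : Fin k → ℕ) (n : Fin ℓ → ℕ) →
    InDtilde k ℓ m n →
    (i : Fin k) → ceilDiv ℓ k ≤ m i
lemma2p6 k ℓ _ m n (_ , _ , s , _ , rv , V , W , (rowV , colV) , (rowW , _) , VᵀW-positive) i =
  ceilDiv-least ℓ k (m i) (begin
    ℓ                                  ≤⟨ length≤sumFin ℓ (transMul V W i) (VᵀW-positive i) ⟩
    sumFin ℓ (transMul V W i)          ≡⟨ rowSum-transMul V W rv rowW i ⟩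
    ∑[ t < s ] (b2n (V t i) * rv t)    ≤⟨ ∑-weighted-≤ k rv (λ t → b2n (V t i)) rv≤k ⟩
    k * sum (λ t → b2n (V t i))        ≡⟨ cong (k *_) (trans (sym (sumFin≡sum s _)) (colV i)) ⟩
    k * m i                            ≡⟨ *-comm k (m i) ⟩
    m i * k                            ∎)
  where
  open ≤-Reasoning
  rv≤k : ∀ t → rv t ≤ k
  rv≤k t = subst (_≤ k) (rowV t) (sumFin-b2n≤length k (V t))
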